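{- For a fixed simple graph $H$ with at least two edges and every positive integer $n$, $\mathrm{ex}^{=1}(n,H)\leq2\cdot\mathrm{ex}(n,H)$.
   Context: $\mathrm{ex}(n,H)$ (the Turán number) is the maximum number of edges in an $n$-vertex graph with no subgraph isomorphic to $H$. $\mathrm{ex}^{=1}(n,H)$ is the maximum number of edges in an $n$-vertex graph in which every edge is contained in exactly one copy of $H$ (copy meaning a subgraph isomorphic to $H$). -}

module Defs where

open import Data.Nat using (ℕ; _≤_; _<ᵇ_)
open import Data.Fin using (Fin; toℕ)
open import Data.Bool using (Bool; true; false; if_then_else_; _∧_)
open import Data.List using (List; map; allFin)
open import Data.Nat.ListAction using (sum)
open import Data.Product using (Σ; ∃; _×_)
open import Relation.Binary.PropositionalEquality using (_≡_)
open import Relation.Nullary using (¬_)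
open import Function.Definitions using (Injective)

record Graph (n : ℕ) : Set where
  field
    adj    : Fin n → Fin n → Bool
    sym    : ∀ i j → adj i j ≡ adj j i
    irrefl : ∀ i → adj i i ≡ false
open Graph public

edges : ∀ {n} → Graph n → ℕ
edges {n} G =
  sum (map (λ i → sum (map (λ j → if (toℕ i <ᵇ toℕ j) ∧ adj G i j then 1 else 0)
                           (allFin n)))
           (allFin n))

-- Its image (vertex image + edge image) is a subgraph of G isomorphic to H,
-- i.e. a copy of H; every copy arises this way.
record Embedding {k n : ℕ} (H : Graph k) (G : Graph n) : Set where
  field
    map-v : Fin k → Fin n
    inj   : Injective _≡_ _≡_ map-v
    hom   : ∀ u v → adj H u v ≡ true → adj G (map-v u) (map-v v) ≡ true
open Embedding public

VertexIn : ∀ {k n} {H : Graph k} {G : Graph n} → Embedding H G → Fin n → Set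
VertexIn {k} f x = ∃ λ (u : Fin k) → map-v f u ≡ x

EdgeIn : ∀ {k n} {H : Graph k} {G : Graph n} → Embedding H G → Fin n → Fin n → Set
EdgeIn {k} {H = H} f x y =
  Σ (Fin k) λ u → Σ (Fin k) λ v → adj H u v ≡ true × map-v f u ≡ x × map-v f v ≡ y

SameCopy : ∀ {k n} {H : Graph k} {G : Graph n} → Embedding H G → Embedding H G → Set
SameCopy f g =
  (∀ x → (VertexIn f x → VertexIn g x) × (VertexIn g x → VertexIn f x)) ×
  (∀ x y → (EdgeIn f x y → EdgeIn g x y) × (EdgeIn g x y → EdgeIn f x y))

ExactlyOneCopy : ∀ {k n} → Graph k → Graph n → Set
ExactlyOneCopy H G =
  ∀ x y → adj G x y ≡ true →
    Σ (Embedding H G) λ f → EdgeIn f x y ×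
      (∀ (g : Embedding H G) → EdgeIn g x y → SameCopy f g)

HFree : ∀ {k n} → Graph k → Graph n → Set
HFree H G = ¬ Embedding H G

IsEx : ∀ {k} → ℕ → Graph k → ℕ → Set
IsEx n H m =
  (Σ (Graph n) λ G → HFree H G × edges G ≡ m) ×
  (∀ (G : Graph n) → HFree H G → edges G ≤ m)

IsExOne : ∀ {k} → ℕ → Graph k → ℕ → Set
IsExOne n H m =
  (Σ (Graph n) λ G → ExactlyOneCopy H G × edges G ≡ m) ×
  (∀ (G : Graph n) → ExactlyOneCopy H G → edges G ≤ m)

{-# OPTIONS --safe #-}
module Submission where

-- Since every edge of G lies in exactly one copy of H, the relation "p and q are edges of a common
-- copy" is a partial equivalence on vertex pairs whose classes are the edge sets of the copies, each
-- of size e(H) ≥ 2. Delete from every class its first edge in a fixed enumeration of the pairs. The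
-- resulting graph G′ is H-free: a copy of H in G′ is a copy in G, so its edges form a whole class,
-- deleted edge included. Sending each deleted edge to the second edge of its class is injective
-- (the class, hence the deleted edge, is recovered from it) and hits only kept edges, so
-- e(G) ≤ 2 e(G′) ≤ 2 ex(n, H).

open import Defs
open import Data.Nat using (ℕ; _≤_; _*_; _+_; suc; z≤n; s≤s; s≤s⁻¹)
import Data.Nat.Properties
open import Data.Nat.Properties using (+-suc; +-identityʳ; +-monoʳ-≤; *-monoʳ-≤; ≤-trans)
open import Data.Nat.ListAction using (sum)
open import Data.Nat.ListAction.Properties using (sum-++)
open import Data.Bool using (Bool; true; false; if_then_else_; _∧_; _∨_; not; T?)
open import Data.Bool.Properties using (T-≡; ∨-comm; ∧-zeroʳ)
import Data.Bool.Properties as Bool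
open import Data.Fin using (Fin; _<_)
open import Data.Fin.Properties using (_≟_; _<?_; <-cmp; <-asym; any?)
open import Data.List using (List; []; _∷_; _++_; map; filter; find; length; allFin; cartesianProduct)
open import Data.List.Properties using (map-++; map-∘; map-cong; length-removeAt′)
open import Data.List.Membership.Propositional using (_∈_; _─_)
open import Data.List.Membership.Propositional.Properties
  using (∈-filter⁺; ∈-filter⁻; ∈-allFin; ∈-cartesianProduct⁺)
open import Data.List.Relation.Unary.Any using (here; there; index)
import Data.List.Relation.Unary.All as All
open import Data.List.Relation.Unary.AllPairs using (_∷_)
open import Data.List.Relation.Unary.Unique.Propositional using (Unique)
open import Data.List.Relation.Unary.Unique.Propositional.Properties
  using (filter⁺; allFin⁺; cartesianProduct⁺)
open import Data.Maybe using (Maybe; just; fromMaybe)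
open import Data.Maybe.Properties using (just-injective)
import Data.Maybe.Properties as Maybe
open import Data.Product using (Σ; ∃; ∃₂; _×_; _,_; proj₁; proj₂)
import Data.Product.Properties as Product
open import Data.Sum using (_⊎_; inj₁; inj₂)
open import Function using (_∘_; _⇔_; mk⇔; Equivalence)
open Equivalence using (to; from)
open import Level using (Level; 0ℓ)
open import Relation.Binary
  using (Rel; Decidable; DecidableEquality; IsPartialEquivalence; tri<; tri≈; tri>)
import Relation.Binary.PropositionalEquality as ≡
open import Relation.Binary.PropositionalEquality
  using (_≡_; _≢_; refl; trans; cong; cong₂; module ≡-Reasoning)
open import Relation.Nullary using (yes; no; does; ¬_; contradiction)
open import Relation.Nullary.Decidable using (dec-true; dec-false; does-⇔; ¬?; _×-dec_)
import Relation.Nullary.Decidable as Dec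
open import Relation.Unary using (Pred)
import Relation.Unary as U
open import Relation.Unary.Properties using (_∩?_; ∁?)

private
  variable
    ℓ ℓ′ : Level
    A B : Set
    k n : ℕ

count : {P : Pred A ℓ} → U.Decidable P → List A → ℕ
count P? = sum ∘ map (λ x → if does (P? x) then 1 else 0)

module _ {P : Pred A ℓ} (P? : U.Decidable P) where

  count-++ : ∀ xs ys → count P? (xs ++ ys) ≡ count P? xs + count P? ys
  count-++ xs ys = trans (cong sum (map-++ _ xs ys)) (sum-++ (map _ xs) _)

  count-map : (f : B → A) (xs : List B) → count P? (map f xs) ≡ count (P? ∘ f) xs
  count-map f xs = cong sum (≡.sym (map-∘ xs))

  count-cong : {Q : Pred A ℓ′} (Q? : U.Decidable Q) → (∀ x → does (P? x) ≡ does (Q? x)) →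
               ∀ xs → count P? xs ≡ count Q? xs
  count-cong Q? same xs = cong sum (map-cong (λ x → cong (λ b → if b then 1 else 0) (same x)) xs)

  count≡length-filter : ∀ xs → count P? xs ≡ length (filter P? xs)
  count≡length-filter []       = refl
  count≡length-filter (x ∷ xs) with does (P? x)
  ... | true  = cong suc (count≡length-filter xs)
  ... | false = count≡length-filter xs

  count-split : {Q : Pred A ℓ′} (Q? : U.Decidable Q) →
                ∀ xs → count P? xs ≡ count (P? ∩? ∁? Q?) xs + count (P? ∩? Q?) xs
  count-split Q? []       = refl
  count-split Q? (x ∷ xs) with does (P? x) | does (Q? x)
  ... | false | _     = count-split Q? xs
  ... | true  | false = cong suc (count-split Q? xs)
  ... | true  | true  = trans (cong suc (count-split Q? xs)) (≡.sym (+-suc _ _))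

  count≥1⇒∃ : ∀ xs → 1 ≤ count P? xs → ∃ λ x → x ∈ xs × P x
  count≥1⇒∃ (x ∷ xs) 1≤count with P? x
  ... | yes px = x , here refl , px
  ... | no _   = let y , y∈xs , py = count≥1⇒∃ xs 1≤count in y , there y∈xs , py

  count≥2⇒distinct : ∀ {xs} → Unique xs → 2 ≤ count P? xs → ∃₂ λ x y → x ≢ y × P x × P y
  count≥2⇒distinct {x ∷ xs} (x∉xs ∷ xs!) 2≤count with P? x
  ... | yes px = let y , y∈xs , py = count≥1⇒∃ xs (s≤s⁻¹ 2≤count)
                 in x , y , All.lookup x∉xs y∈xs , px , py
  ... | no _   = count≥2⇒distinct xs! 2≤count

  find-sound : ∀ xs {y} → find P? xs ≡ just y → P y
  find-sound (x ∷ xs) found with P? x | found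
  ... | yes px | refl   = px
  ... | no _   | found′ = find-sound xs found′

  find-complete : ∀ {xs x} → x ∈ xs → P x → ∃ λ y → find P? xs ≡ just y
  find-complete {x′ ∷ xs} x∈xs px with P? x′ | x∈xs
  ... | yes _  | _           = x′ , refl
  ... | no ¬px | here refl   = contradiction px ¬px
  ... | no _   | there x∈xs′ = find-complete x∈xs′ px

  find-cong : {Q : Pred A ℓ′} (Q? : U.Decidable Q) → (∀ x → does (P? x) ≡ does (Q? x)) →
              ∀ xs → find P? xs ≡ find Q? xs
  find-cong Q? same []       = refl
  find-cong Q? same (x ∷ xs) rewrite same x =
    cong (if does (Q? x) then just x else_) (find-cong Q? same xs)

count-cartesianProduct : {P : Pred (A × B) ℓ} (P? : U.Decidable P) (xs : List A) (ys : List B) →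
  count P? (cartesianProduct xs ys) ≡ sum (map (λ x → count (P? ∘ (x ,_)) ys) xs)
count-cartesianProduct P? []       ys = refl
count-cartesianProduct P? (x ∷ xs) ys = begin
  count P? (map (x ,_) ys ++ cartesianProduct xs ys)
    ≡⟨ count-++ P? (map (x ,_) ys) _ ⟩
  count P? (map (x ,_) ys) + count P? (cartesianProduct xs ys)
    ≡⟨ cong₂ _+_ (count-map P? (x ,_) ys) (count-cartesianProduct P? xs ys) ⟩
  count (P? ∘ (x ,_)) ys + sum (map (λ x → count (P? ∘ (x ,_)) ys) xs)
    ∎
  where open ≡-Reasoning

∈-─ : ∀ {x y : A} {ys} (x∈ys : x ∈ ys) → y ∈ ys → y ≢ x → y ∈ ys ─ x∈ys
∈-─ (here refl)  (here refl)  y≢x = contradiction refl y≢x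
∈-─ (here refl)  (there y∈ys) _   = y∈ys
∈-─ (there _)    (here refl)  _   = here refl
∈-─ (there x∈ys) (there y∈ys) y≢x = there (∈-─ x∈ys y∈ys y≢x)

length-≤-injection : ∀ {xs : List A} {ys : List B} → Unique xs → (f : A → B) →
  (∀ {x y} → x ∈ xs → y ∈ xs → f x ≡ f y → x ≡ y) → (∀ {x} → x ∈ xs → f x ∈ ys) →
  length xs ≤ length ys
length-≤-injection {xs = []}     _            _ _     _      = z≤n
length-≤-injection {xs = x ∷ xs} {ys} (x∉xs ∷ xs!) f f-inj f-into = begin
  suc (length xs)           ≤⟨ s≤s (length-≤-injection xs! f f-inj′ f-into′) ⟩
  suc (length (ys ─ fx∈ys)) ≡⟨ length-removeAt′ ys (index fx∈ys) ⟨
  length ys                 ∎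
  where
  open Data.Nat.Properties.≤-Reasoning
  fx∈ys : f x ∈ ys
  fx∈ys = f-into (here refl)
  f-inj′ : ∀ {y z} → y ∈ xs → z ∈ xs → f y ≡ f z → y ≡ z
  f-inj′ y∈xs z∈xs = f-inj (there y∈xs) (there z∈xs)
  f-into′ : ∀ {y} → y ∈ xs → f y ∈ ys ─ fx∈ys
  f-into′ y∈xs = ∈-─ fx∈ys (f-into (there y∈xs))
    (λ fy≡fx → All.lookup x∉xs y∈xs (≡.sym (f-inj (there y∈xs) (here refl) fy≡fx)))

count-≤-injection : ∀ {P : Pred A ℓ} {Q : Pred B ℓ′} (P? : U.Decidable P) (Q? : U.Decidable Q)
  {xs : List A} {ys : List B} → Unique xs → (∀ y → y ∈ ys) → (f : A → B) →
  (∀ {x} → P x → Q (f x)) → (∀ {x y} → P x → P y → f x ≡ f y → x ≡ y) →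
  count P? xs ≤ count Q? ys
count-≤-injection {P = P} P? Q? {xs} {ys} xs! ∈ys f f-maps f-inj = begin
  count P? xs           ≡⟨ count≡length-filter P? xs ⟩
  length (filter P? xs) ≤⟨ length-≤-injection (filter⁺ P? xs!) f
                             (λ x∈ y∈ → f-inj (P-of x∈) (P-of y∈))
                             (λ x∈ → ∈-filter⁺ Q? (∈ys _) (f-maps (P-of x∈))) ⟩
  length (filter Q? ys) ≡⟨ count≡length-filter Q? ys ⟨
  count Q? ys           ∎
  where
  open Data.Nat.Properties.≤-Reasoning
  P-of : ∀ {x} → x ∈ filter P? xs → P x
  P-of = proj₂ ∘ ∈-filter⁻ P? {xs = xs}

module Leaders {_~_ : Rel A ℓ} (~-isPER : IsPartialEquivalence _~_) (_~?_ : Decidable _~_)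
               (_≟ᴬ_ : DecidableEquality A) {xs : List A} (xs! : Unique xs) (∈xs : ∀ a → a ∈ xs)
               where

  open IsPartialEquivalence ~-isPER renaming (sym to ~-sym; trans to ~-trans)

  dom? : U.Decidable (λ a → a ~ a)
  dom? a = a ~? a

  leader : A → Maybe A
  leader a = find (a ~?_) xs

  IsLeader : Pred A 0ℓ
  IsLeader a = leader a ≡ just a

  isLeader? : U.Decidable IsLeader
  isLeader? a = Maybe.≡-dec _≟ᴬ_ (leader a) (just a)

  Follower : Pred A ℓ
  Follower a = a ~ a × ¬ IsLeader a

  follower? : U.Decidable Follower
  follower? = dom? ∩? ∁? isLeader?

  leader-related : ∀ {a l} → leader a ≡ just l → a ~ l
  leader-related {a} = find-sound (a ~?_) xs

  leader-cong : ∀ {a b} → a ~ b → leader a ≡ leader b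
  leader-cong {a} {b} a~b = find-cong (a ~?_) (b ~?_)
    (λ c → does-⇔ (mk⇔ (~-trans (~-sym a~b)) (~-trans a~b)) (a ~? c) (b ~? c)) xs

  leader-exists : ∀ {a} → a ~ a → ∃ λ l → a ~ l × IsLeader l
  leader-exists {a} a~a =
    let l , found = find-complete (a ~?_) (∈xs a) a~a
        a~l       = leader-related found
    in l , a~l , trans (leader-cong (~-sym a~l)) found

  module _ (classes≥2 : ∀ {a} → a ~ a → 2 ≤ count (a ~?_) xs) where

    another-in-class : ∀ {a} → a ~ a → ∃ λ b → a ~ b × b ≢ a
    another-in-class {a} a~a
      with b , c , b≢c , a~b , a~c ← count≥2⇒distinct (a ~?_) xs! (classes≥2 a~a)
      with b ≟ᴬ a
    ... | yes refl = c , a~c , λ c≡b → b≢c (≡.sym c≡b)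
    ... | no b≢a   = b , a~b , b≢a

    other? : ∀ a → U.Decidable (λ b → a ~ b × b ≢ a)
    other? a b = (a ~? b) ×-dec ¬? (b ≟ᴬ a)

    second : A → A
    second a = fromMaybe a (find (other? a) xs)

    second-spec : ∀ {a} → a ~ a → a ~ second a × second a ≢ a
    second-spec {a} a~a
      with b , a~b , b≢a ← another-in-class a~a
      with c , found     ← find-complete (other? a) (∈xs b) (a~b , b≢a)
      rewrite found = find-sound (other? a) xs found

    leader-second : ∀ {a} → IsLeader a → leader (second a) ≡ just a
    leader-second a-leads =
      trans (leader-cong (~-sym (proj₁ (second-spec (leader-related a-leads))))) a-leads

    at-most-half-leaders : count dom? xs ≤ 2 * count follower? xs
    at-most-half-leaders = begin
      count dom? xs                            ≡⟨ count-split dom? isLeader? xs ⟩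
      followers + count (dom? ∩? isLeader?) xs ≤⟨ +-monoʳ-≤ followers
                                                    (count-≤-injection (dom? ∩? isLeader?) follower?
                                                       xs! ∈xs second second-follows second-injective) ⟩
      followers + followers                    ≡⟨ cong (followers +_) (+-identityʳ followers) ⟨
      2 * followers                            ∎
      where
      open Data.Nat.Properties.≤-Reasoning
      followers : ℕ
      followers = count follower? xs
      second-follows : ∀ {a} → a ~ a × IsLeader a → Follower (second a)
      second-follows (a~a , a-leads) =
        let a~s , s≢a = second-spec a~a
        in ~-trans (~-sym a~s) a~s ,
           λ s-leads → s≢a (just-injective (trans (≡.sym s-leads) (leader-second a-leads)))
      second-injective : ∀ {a b} → a ~ a × IsLeader a → b ~ b × IsLeader b →
                         second a ≡ second b → a ≡ b
      second-injective (_ , a-leads) (_ , b-leads) same = just-injective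
        (trans (≡.sym (leader-second a-leads)) (trans (cong leader same) (leader-second b-leads)))

Pair : ℕ → Set
Pair n = Fin n × Fin n

pairs : (n : ℕ) → List (Pair n)
pairs n = cartesianProduct (allFin n) (allFin n)

pairs! : Unique (pairs n)
pairs! {n} = cartesianProduct⁺ (allFin⁺ n) (allFin⁺ n)

∈-pairs : (p : Pair n) → p ∈ pairs n
∈-pairs (x , y) = ∈-cartesianProduct⁺ (∈-allFin x) (∈-allFin y)

_≟ₚ_ : DecidableEquality (Pair n)
_≟ₚ_ = Product.≡-dec _≟_ _≟_

IsEdge : Graph n → Pred (Pair n) 0ℓ
IsEdge G (x , y) = x < y × adj G x y ≡ true

isEdge? : (G : Graph n) → U.Decidable (IsEdge G)
isEdge? G (x , y) = (x <? y) ×-dec Dec.map T-≡ (T? (adj G x y))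

edges≡count : (G : Graph n) → edges G ≡ count (isEdge? G) (pairs n)
edges≡count {n} G = ≡.sym (count-cartesianProduct (isEdge? G) (allFin n) (allFin n))

orient : Fin n → Fin n → Pair n
orient x y = if does (x <? y) then (x , y) else (y , x)

orient-inv : ∀ (a b c d : Fin n) → orient a b ≡ orient c d → (a ≡ c × b ≡ d) ⊎ (a ≡ d × b ≡ c)
orient-inv a b c d same with does (a <? b) | does (c <? d) | same
... | true  | true  | refl = inj₁ (refl , refl)
... | true  | false | refl = inj₂ (refl , refl)
... | false | true  | refl = inj₂ (refl , refl)
... | false | false | refl = inj₁ (refl , refl)

module _ {H : Graph k} {G : Graph n} where

  IsCopyEdge : Embedding H G → Pred (Pair n) 0ℓ
  IsCopyEdge f (x , y) = x < y × EdgeIn f x y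

  isCopyEdge? : (f : Embedding H G) → U.Decidable (IsCopyEdge f)
  isCopyEdge? f (x , y) = (x <? y) ×-dec
    any? λ u → any? λ v → (adj H u v Bool.≟ true) ×-dec (map-v f u ≟ x) ×-dec (map-v f v ≟ y)

  EdgeIn-sym : (f : Embedding H G) → ∀ {x y} → EdgeIn f x y → EdgeIn f y x
  EdgeIn-sym f (u , v , uv , refl , refl) = v , u , trans (Graph.sym H v u) uv , refl , refl

  EdgeIn⇒adj : (f : Embedding H G) → ∀ {x y} → EdgeIn f x y → adj G x y ≡ true
  EdgeIn⇒adj f (u , v , uv , refl , refl) = hom f u v uv

  IsCopyEdge⇒IsEdge : (f : Embedding H G) → ∀ {p} → IsCopyEdge f p → IsEdge G p
  IsCopyEdge⇒IsEdge f {_ , _} (x<y , xy) = x<y , EdgeIn⇒adj f xy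

  orient-IsCopyEdge : (f : Embedding H G) → ∀ {x y} → EdgeIn f x y → IsCopyEdge f (orient x y)
  orient-IsCopyEdge f {x} {y} xy with <-cmp x y
  ... | tri< x<y _ _   rewrite dec-true (x <? y) x<y  = x<y , xy
  ... | tri≈ _ refl _  = contradiction (trans (≡.sym (EdgeIn⇒adj f xy)) (irrefl G x)) λ ()
  ... | tri> x≮y _ y<x rewrite dec-false (x <? y) x≮y = y<x , EdgeIn-sym f xy

  edges≤count-copyEdges : (f : Embedding H G) → edges H ≤ count (isCopyEdge? f) (pairs n)
  edges≤count-copyEdges f = begin
    edges H                         ≡⟨ edges≡count H ⟩
    count (isEdge? H) (pairs k)     ≤⟨ count-≤-injection (isEdge? H) (isCopyEdge? f) pairs! ∈-pairs image
                                         (λ {(u , v)} (_ , uv) → orient-IsCopyEdge f (u , v , uv , refl , refl))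
                                         image-injective ⟩
    count (isCopyEdge? f) (pairs n) ∎
    where
    open Data.Nat.Properties.≤-Reasoning
    image : Pair k → Pair n
    image (u , v) = orient (map-v f u) (map-v f v)
    image-injective : ∀ {p q} → IsEdge H p → IsEdge H q → image p ≡ image q → p ≡ q
    image-injective {u , v} {u′ , v′} (u<v , _) (u′<v′ , _) same
      with orient-inv (map-v f u) (map-v f v) (map-v f u′) (map-v f v′) same
    ... | inj₁ (fu≡fu′ , fv≡fv′) = cong₂ _,_ (inj f fu≡fu′) (inj f fv≡fv′)
    ... | inj₂ (fu≡fv′ , fv≡fu′) with inj f fu≡fv′ | inj f fv≡fu′
    ...   | refl | refl = contradiction u<v (<-asym u′<v′)

module _ {H : Graph k} {G : Graph n} (one-copy : ExactlyOneCopy H G) where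

  EdgeIn-transfer : (f g : Embedding H G) → ∀ {x y a b} →
    EdgeIn f x y → EdgeIn g x y → EdgeIn f a b → EdgeIn g a b
  EdgeIn-transfer f g {x} {y} {a} {b} fxy gxy fab =
    let _ , _ , only = one-copy x y (EdgeIn⇒adj f fxy)
    in proj₁ (proj₂ (only g gxy) a b) (proj₂ (proj₂ (only f fxy) a b) fab)

  IsCopyEdge-transfer : (f g : Embedding H G) → ∀ {p q} →
    IsCopyEdge f p → IsCopyEdge g p → IsCopyEdge f q → IsCopyEdge g q
  IsCopyEdge-transfer f g {_ , _} {_ , _} (_ , fp) (_ , gp) (q< , fq) = q< , EdgeIn-transfer f g fp gp fq

  _~_ : Rel (Pair n) 0ℓ
  p ~ q = Σ (Embedding H G) λ f → IsCopyEdge f p × IsCopyEdge f q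

  ~-isPER : IsPartialEquivalence _~_
  ~-isPER = record
    { sym   = λ (f , fp , fq) → f , fq , fp
    ; trans = λ (f , fp , fq) (g , gq , gr) → g , IsCopyEdge-transfer f g fq gq fp , gr
    }

  copyThrough : ∀ {p} → IsEdge G p → Σ (Embedding H G) λ f → IsCopyEdge f p
  copyThrough {x , y} (x<y , xy) = let f , fxy , _ = one-copy x y xy in f , x<y , fxy

  _~?_ : Decidable _~_
  p ~? q with isEdge? G p
  ... | no ¬p = no λ (f , fp , _) → ¬p (IsCopyEdge⇒IsEdge f fp)
  ... | yes p-edge with copyThrough p-edge
  ...   | f , fp with isCopyEdge? f q
  ...     | yes fq = yes (f , fp , fq)
  ...     | no ¬fq = no λ (g , gp , gq) → ¬fq (IsCopyEdge-transfer g f gp fp gq)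

  ~-refl⇔IsEdge : ∀ {p} → p ~ p ⇔ IsEdge G p
  ~-refl⇔IsEdge = mk⇔ (λ (f , fp , _) → IsCopyEdge⇒IsEdge f fp)
                      (λ p-edge → let f , fp = copyThrough p-edge in f , fp , fp)

  ~-classes≥2 : 2 ≤ edges H → ∀ {p} → p ~ p → 2 ≤ count (p ~?_) (pairs n)
  ~-classes≥2 2≤eH {p} (f , fp , _) = begin
    2                               ≤⟨ 2≤eH ⟩
    edges H                         ≤⟨ edges≤count-copyEdges f ⟩
    count (isCopyEdge? f) (pairs n) ≤⟨ count-≤-injection (isCopyEdge? f) (p ~?_) pairs! ∈-pairs (λ q → q)
                                         (λ fq → f , fp , fq) (λ _ _ same → same) ⟩
    count (p ~?_) (pairs n)         ∎
    where open Data.Nat.Properties.≤-Reasoning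

  open Leaders ~-isPER _~?_ _≟ₚ_ pairs! ∈-pairs

  removed : Fin n → Fin n → Bool
  removed x y = does (isLeader? (x , y)) ∨ does (isLeader? (y , x))

  withoutLeaders : Graph n
  withoutLeaders = record
    { adj    = λ x y → not (removed x y) ∧ adj G x y
    ; sym    = λ x y → cong₂ _∧_ (cong not (∨-comm (does (isLeader? (x , y))) _)) (Graph.sym G x y)
    ; irrefl = λ x → trans (cong (not (removed x x) ∧_) (irrefl G x)) (∧-zeroʳ _)
    }

  adj-withoutLeaders : ∀ {x y} → adj withoutLeaders x y ≡ true ⇔
                       (adj G x y ≡ true × ¬ IsLeader (x , y) × ¬ IsLeader (y , x))
  adj-withoutLeaders {x} {y} with isLeader? (x , y) | isLeader? (y , x)
  ... | yes xy-leads   | _            = mk⇔ (λ ()) (λ (_ , ¬xy-leads , _) → contradiction xy-leads ¬xy-leads)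
  ... | no _           | yes yx-leads = mk⇔ (λ ()) (λ (_ , _ , ¬yx-leads) → contradiction yx-leads ¬yx-leads)
  ... | no ¬xy-leads   | no ¬yx-leads = mk⇔ (λ xy → xy , ¬xy-leads , ¬yx-leads) proj₁

  IsLeader⇒IsEdge : ∀ {p} → IsLeader p → IsEdge G p
  IsLeader⇒IsEdge p-leads = to ~-refl⇔IsEdge (leader-related p-leads)

  IsEdge-withoutLeaders⇔ : ∀ {p} → IsEdge withoutLeaders p ⇔ Follower p
  IsEdge-withoutLeaders⇔ {x , y} = mk⇔
    (λ (x<y , xy) → let xy-in-G , ¬xy-leads , _ = to adj-withoutLeaders xy
                    in from ~-refl⇔IsEdge (x<y , xy-in-G) , ¬xy-leads)
    (λ (p~p , ¬xy-leads) →
       let x<y , xy-in-G = to ~-refl⇔IsEdge p~p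
           ¬yx-leads     = λ yx-leads → <-asym x<y (proj₁ (IsLeader⇒IsEdge yx-leads))
       in x<y , from adj-withoutLeaders (xy-in-G , ¬xy-leads , ¬yx-leads))

  edges≤2*edges-withoutLeaders : 2 ≤ edges H → edges G ≤ 2 * edges withoutLeaders
  edges≤2*edges-withoutLeaders 2≤eH = begin
    edges G                                      ≡⟨ edges≡count G ⟩
    count (isEdge? G) (pairs n)                  ≡⟨ count-cong dom? (isEdge? G) same-domain (pairs n) ⟨
    count dom? (pairs n)                         ≤⟨ at-most-half-leaders (~-classes≥2 2≤eH) ⟩
    2 * count follower? (pairs n)                ≡⟨ cong (2 *_) (count-cong G′-edge? follower? same-followers (pairs n)) ⟨
    2 * count G′-edge? (pairs n)                 ≡⟨ cong (2 *_) (edges≡count withoutLeaders) ⟨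
    2 * edges withoutLeaders                     ∎
    where
    open Data.Nat.Properties.≤-Reasoning
    G′-edge? : U.Decidable (IsEdge withoutLeaders)
    G′-edge? = isEdge? withoutLeaders
    same-domain : ∀ p → does (dom? p) ≡ does (isEdge? G p)
    same-domain p = does-⇔ ~-refl⇔IsEdge (dom? p) (isEdge? G p)
    same-followers : ∀ p → does (G′-edge? p) ≡ does (follower? p)
    same-followers p = does-⇔ IsEdge-withoutLeaders⇔ (G′-edge? p) (follower? p)

  withoutLeaders-HFree : 1 ≤ edges H → HFree H withoutLeaders
  withoutLeaders-HFree 1≤eH g =
    let g-in-G : Embedding H G
        g-in-G = record { map-v = map-v g ; inj = inj g
                        ; hom = λ u v uv → proj₁ (to adj-withoutLeaders (hom g u v uv)) }
        p , _ , gp = count≥1⇒∃ (isCopyEdge? g-in-G) (pairs n)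
                       (≤-trans 1≤eH (edges≤count-copyEdges g-in-G))
        (x , y) , (f , fp , fxy) , xy-leads = leader-exists (g-in-G , gp , gp)
        _ , gxy = IsCopyEdge-transfer f g-in-G fp gp fxy
    in proj₁ (proj₂ (to adj-withoutLeaders (EdgeIn⇒adj g gxy))) xy-leads

proposition2p10 : ∀ {k : ℕ} (H : Graph k) → 2 ≤ edges H →
    ∀ (n : ℕ) → 1 ≤ n → ∀ (a b : ℕ) → IsExOne n H a → IsEx n H b → a ≤ 2 * b
proposition2p10 H 2≤eH n _ a b ((G , one-copy , refl) , _) (_ , ex-maximal) = begin
  edges G                             ≤⟨ edges≤2*edges-withoutLeaders one-copy 2≤eH ⟩
  2 * edges (withoutLeaders one-copy) ≤⟨ *-monoʳ-≤ 2 (ex-maximal _ G′-HFree) ⟩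
  2 * b                               ∎
  where
  open Data.Nat.Properties.≤-Reasoning
  G′-HFree : HFree H (withoutLeaders one-copy)
  G′-HFree = withoutLeaders-HFree one-copy (≤-trans (s≤s z≤n) 2≤eH)
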